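{- Let $B$ be a Boolean algebra with an $M$-ideal $I$, and for each positive integer $n$ let $C_n=\{a\in B^+ : a\neq a_n \text{ for every } \{a_j\}_j\in I\}$. Then for every $n$ there is a constant $K_n$ such that every antichain $A\subseteq C_n$ has at most $K_n$ elements.
   Context: A Boolean algebra here is an algebra $B$ of subsets of a nonempty set $S$ with operations $\cup,\cap$, complement, $\mathbf 0=\emptyset$, $\mathbf 1=S$, and $a\le b$ iff $a\subseteq b$; $B^+=B\setminus\{\mathbf 0\}$. An antichain is a set of pairwise disjoint elements of $B^+$. Sequences are indexed by positive integers. A set $I$ of infinite sequences in $B^+$ is an $M$-ideal if: (M1) if $\{a_n\}_n\in I$ then there is no $a>\mathbf 0$ with $a\le a_n$ for all $n$; (M2) if $s\in I$ and $t$ is an infinite subsequence of $s$ then $t\in I$; (M3) if $\{a_n\}_n\in I$ and $b_n\in B^+$ with $b_n\le a_n$ for all $n$ then $\{b_n\}_n\in I$; (M4) if $\{a_n\}_n,\{b_n\}_n\in I$ then $\{a_n\cup b_n\}_n$ has an infinite subsequence in $I$; (M5) if $\{a^k_n\}_n\in I$ for every $k$, then $\{a^n_n\}_n\in I$; (M6) if for every $n$, $A_n$ is a finite antichain with $|A_n|\ge n$, then there exist $a_n\in A_n$ with $\{a_n\}_n\in I$. -}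

module Defs where

open import Level using (Level; _⊔_; suc)
open import Data.Nat using (ℕ; _<_; _≤_)
open import Data.Fin using (Fin)
open import Data.List using (List; length; lookup)
open import Data.Product using (Σ; _×_; ∃)
open import Data.Empty using (⊥)
open import Relation.Binary.PropositionalEquality using (_≢_)
open import Relation.Nullary using (¬_)
open import Algebra.Lattice.Bundles using (BooleanAlgebra)

-- Boolean algebras are the stdlib's abstract Boolean algebras (a setoid with
-- ∨, ∧, ¬, ⊤, ⊥); by Stone's representation theorem these are exactly (up to
-- isomorphism) the algebras of subsets of a set used in the paper.
-- Nonemptiness of S corresponds to nontriviality ⊤ ≉ ⊥.
module BA {c ℓ : Level} (B : BooleanAlgebra c ℓ) where
  open BooleanAlgebra B renaming (⊥ to 𝟘; ⊤ to 𝟙; ¬_ to ∁_)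

  Nontrivial : Set ℓ
  Nontrivial = ¬ (𝟙 ≈ 𝟘)

  _≼_ : Carrier → Carrier → Set ℓ
  a ≼ b = a ∧ b ≈ a

  Pos : Carrier → Set ℓ
  Pos a = ¬ (a ≈ 𝟘)

  -- Sequences; 0-based: s k is the (k+1)-th term of the paper's sequence.
  Seq : Set c
  Seq = ℕ → Carrier

  PosSeq : Seq → Set ℓ
  PosSeq s = ∀ n → Pos (s n)

  StrictlyIncreasing : (ℕ → ℕ) → Set
  StrictlyIncreasing φ = ∀ m n → m < n → φ m < φ n

  -- finite antichain: pairwise disjoint elements of B⁺ (listed without repetition;
  -- pairwise disjoint positive elements are automatically distinct)
  Antichain : List Carrier → Set ℓ
  Antichain A = (∀ i → Pos (lookup A i))
              × (∀ i j → i ≢ j → lookup A i ∧ lookup A j ≈ 𝟘)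

  record IsMIdeal {i : Level} (I : Seq → Set i) : Set (suc (c ⊔ ℓ ⊔ i)) where
    field
      inB⁺ : ∀ s → I s → PosSeq s
      M1 : ∀ s → I s → ¬ (Σ Carrier λ a → Pos a × (∀ n → a ≼ s n))
      M2 : ∀ s φ → StrictlyIncreasing φ → I s → I (λ n → s (φ n))
      M3 : ∀ a b → I a → PosSeq b → (∀ n → b n ≼ a n) → I b
      M4 : ∀ a b → I a → I b →
           Σ (ℕ → ℕ) λ φ → StrictlyIncreasing φ × I (λ n → a (φ n) ∨ b (φ n))
      M5 : ∀ (a : ℕ → Seq) → (∀ k → I (a k)) → I (λ n → a n n)
      -- the n-th antichain (paper index n = k+1) has at least k+1 elements
      M6 : ∀ (A : ℕ → List Carrier) → (∀ k → Antichain (A k)) →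
           (∀ k → Data.Nat.suc k ≤ length (A k)) →
           Σ ((k : ℕ) → Fin (length (A k))) λ f → I (λ k → lookup (A k) (f k))

  -- membership in C_{m+1} (0-based index m):
  -- a ∈ B⁺ and a differs from the (m+1)-th term of every sequence in I
  InC : {i : Level} → (Seq → Set i) → ℕ → Carrier → Set (c ⊔ ℓ ⊔ i)
  InC I m a = Pos a × (∀ s → I s → ¬ (a ≈ s m))

module Submission where

-- Suppose the antichains contained in C_m had no uniform bound.
-- Then for every k there is an antichain A_k ⊆ C_m with at least k+1
-- elements (this step is classical, hence the excluded-middle hypothesis).
-- Axiom M6 picks a_k ∈ A_k so that the sequence {a_k}_k lies in I.  But then
-- a_m ∈ A_m ⊆ C_m, while by definition no element of C_m may be the m-th term
-- of a sequence in I — a contradiction.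

open import Defs
open import Level using (Level; _⊔_)
open import Data.Nat using (ℕ; _≤_; _≤?_; suc)
open import Data.Nat.Properties using (≰⇒>)
open import Data.Fin using (Fin)
open import Data.List using (List; length; lookup)
open import Data.List.Relation.Unary.All using (All)
import Data.List.Relation.Unary.All as All
open import Data.List.Membership.Propositional.Properties using (∈-lookup)
open import Data.Product using (Σ; _×_; _,_; proj₁; proj₂)
open import Data.Empty using (⊥-elim)
open import Relation.Nullary using (¬_; yes; no)
open import Algebra.Lattice.Bundles using (BooleanAlgebra)
open import Axiom.ExcludedMiddle using (ExcludedMiddle)

BoundedLength : ∀ {a p} {A : Set a} → (List A → Set p) → Set (a ⊔ p)
BoundedLength {A = A} P = Σ ℕ λ K → (xs : List A) → P xs → length xs ≤ K

ArbitrarilyLong : ∀ {a p} {A : Set a} → (List A → Set p) → Set (a ⊔ p)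
ArbitrarilyLong {A = A} P = (k : ℕ) → Σ (List A) λ xs → P xs × suc k ≤ length xs

unbounded⇒arbitrarilyLong : ∀ {a p} {A : Set a} {P : List A → Set p} →
  ExcludedMiddle (a ⊔ p) → ¬ BoundedLength P → ArbitrarilyLong P
unbounded⇒arbitrarilyLong {A = A} {P} em unbounded k with em {Σ (List A) λ xs → P xs × suc k ≤ length xs}
... | yes long = long
... | no noLong = ⊥-elim (unbounded (k , bound))
  where
  bound : (xs : List A) → P xs → length xs ≤ k
  bound xs Pxs with length xs ≤? k
  ... | yes le = le
  ... | no nle = ⊥-elim (noLong (xs , Pxs , ≰⇒> nle))

module _ {c ℓ i : Level} (B : BooleanAlgebra c ℓ)
         (I : BA.Seq B → Set i) (MI : BA.IsMIdeal B I) (m : ℕ) where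
  open BooleanAlgebra B using (Carrier; refl)
  open BA.IsMIdeal MI using (M6)

  AntichainInC : List Carrier → Set (c ⊔ ℓ ⊔ i)
  AntichainInC A = BA.Antichain B A × All (BA.InC B I m) A

  term∉C : ∀ s → I s → ¬ BA.InC B I m (s m)
  term∉C s s∈I (_ , avoids) = avoids s s∈I refl

  -- The core of the lemma: C_m does not contain arbitrarily long antichains,
  -- since M6 would choose from them a sequence in I whose m-th term is in C_m.
  noLongAntichainsInC : ¬ ArbitrarilyLong AntichainInC
  noLongAntichainsInC long = term∉C chosen chosen∈I chosen-m∈C
    where
    A : ℕ → List Carrier
    A k = proj₁ (long k)

    picked : Σ ((k : ℕ) → Fin (length (A k))) λ f → I (λ k → lookup (A k) (f k))
    picked = M6 A (λ k → proj₁ (proj₁ (proj₂ (long k)))) (λ k → proj₂ (proj₂ (long k)))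

    chosen : BA.Seq B
    chosen k = lookup (A k) (proj₁ picked k)

    chosen∈I : I chosen
    chosen∈I = proj₂ picked

    chosen-m∈C : BA.InC B I m (chosen m)
    chosen-m∈C = All.lookup (proj₂ (proj₁ (proj₂ (long m)))) (∈-lookup (proj₁ picked m))

lemma3p3 : {c ℓ i : Level} → ExcludedMiddle (c ⊔ ℓ ⊔ i) →
    (B : BooleanAlgebra c ℓ) → BA.Nontrivial B →
    (I : BA.Seq B → Set i) → BA.IsMIdeal B I →
    (m : ℕ) → Σ ℕ λ K → (A : List (BooleanAlgebra.Carrier B)) →
    BA.Antichain B A → All (BA.InC B I m) A → length A ≤ K
lemma3p3 em B _ I MI m with em {BoundedLength (AntichainInC B I MI m)}
... | yes (K , bounded) = K , λ A antichain inC → bounded A (antichain , inC)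
... | no unbounded =
  ⊥-elim (noLongAntichainsInC B I MI m (unbounded⇒arbitrarilyLong em unbounded))
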